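{- Let $A=(a_{ij})_{1\le i,j\le 3}$ be a $3\times 3$ matrix with positive real entries, and let $x$ be the $(1,1)$ entry of $\mathrm{Sink}(A)$. Then $d_6x^6+d_5x^5+d_4x^4+d_3x^3+d_2x^2+d_1x+d_0=0$, where (writing each set of minor specifications as a set of pairs $(R,C)$) \begin{align*} d_6={}&\Sigma(\{(\{\},\{\}),(\{2\},\{2\}),(\{2\},\{3\}),(\{3\},\{2\}),(\{3\},\{3\}),(\{2,3\},\{2,3\})\}),\\ d_5={}&-3\,\Sigma(\{(\{\},\{\}),(\{2\},\{2\}),(\{2\},\{3\}),(\{3\},\{2\}),(\{3\},\{3\})\})\\ &-\Sigma(\{(\{\},\{\}),(\{2\},\{2\}),(\{2\},\{3\}),(\{3\},\{2\}),(\{2,3\},\{2,3\})\})\\ &+\Sigma(\{(\{2\},\{2\}),(\{2\},\{3\}),(\{3\},\{2\}),(\{3\},\{3\}),(\{2,3\},\{2,3\})\}),\\ d_4={}&4\,\Sigma(\{(\{\},\{\}),(\{2\},\{2\}),(\{2\},\{3\}),(\{3\},\{2\})\})+\Sigma(\{(\{\},\{\}),(\{2\},\{2\}),(\{3\},\{3\}),(\{2,3\},\{2,3\})\})\\ &-3\,\Sigma(\{(\{2\},\{2\}),(\{2\},\{3\}),(\{3\},\{2\}),(\{3\},\{3\})\}),\\ d_3={}&-4\,\Sigma(\{(\{\},\{\}),(\{2\},\{2\}),(\{2\},\{3\})\})-5\,\Sigma(\{(\{\},\{\}),(\{2\},\{2\}),(\{3\},\{3\})\})\\ &+\Sigma(\{(\{\},\{\}),(\{2\},\{2\}),(\{2,3\},\{2,3\})\})+\Sigma(\{(\{2\},\{2\}),(\{2\},\{3\}),(\{3\},\{2\})\})\\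 &-\Sigma(\{(\{2\},\{2\}),(\{3\},\{3\}),(\{2,3\},\{2,3\})\}),\\ d_2={}&4\,\Sigma(\{(\{\},\{\}),(\{2\},\{2\})\})-3\,\Sigma(\{(\{\},\{\}),(\{2,3\},\{2,3\})\})+\Sigma(\{(\{2\},\{2\}),(\{3\},\{3\})\}),\\ d_1={}&-3\,\Sigma(\{(\{\},\{\})\})-\Sigma(\{(\{2\},\{2\})\})+\Sigma(\{(\{2,3\},\{2,3\})\}),\\ d_0={}&\Sigma(\{\}). \end{align*}
   Context: Sinkhorn limit: for a square matrix $A$ with positive entries, $\mathrm{Sink}(A)$ is the unique doubly stochastic matrix $S$ such that $S=RAC$ for diagonal matrices $R,C$ with positive diagonal entries (equivalently, the limit of alternately normalizing row sums and column sums to $1$). Notation for a $3\times3$ matrix $A=(a_{ij})$: let $D=D(3,3)$ be the set of all pairs $(R,C)$ with $R,C\subseteq\{2,3\}$ and $|R|=|C|$; explicitly $D=\{(\{\},\{\}),(\{2\},\{2\}),(\{2\},\{3\}),(\{3\},\{2\}),(\{3\},\{3\}),(\{2,3\},\{2,3\})\}$. For $I,J$ sets of indices, $A_{I,J}$ is the submatrix with rows in $I$ and columns in $J$ (the determinant of the $0\times 0$ matrix is $1$). For $(R,C)\in D$ let $\Delta(R,C)=\det A_{\{1\}\cup R,\{1\}\cup C}$ and $\Gamma(R,C)=a_{11}\det A_{R,C}$. For $S\subseteq D$ let \[M(S)=\prod_{(R,C)\in S}\Delta(R,C)\cdot\prod_{(R,C)\in D\setminus S}\Gamma(R,C).\]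 For $S,T\subseteq D$ write $T\equiv S$ if the set of minors specified by $T$ is transformed into the set specified by $S$ by some composition of row permutations of $A$ fixing the first row, column permutations fixing the first column, and transposition (i.e., $T$ is mapped to $S$ by applying to all index sets a permutation of $\{2,3\}$ on the row indices, a permutation of $\{2,3\}$ on the column indices, and possibly swapping each pair $(R,C)\mapsto(C,R)$). The class sum is $\Sigma(S)=\sum_{T\subseteq D,\ T\equiv S}M(T)$. -}

module Defs where

open import Level using (Level; _⊔_) renaming (suc to lsuc)
open import Data.Nat using (ℕ; zero; suc)
open import Data.Fin using (Fin; zero; suc; punchIn)
open import Data.Bool using (Bool; true; false; if_then_else_; _∧_; _∨_)
open import Data.Vec using (Vec; []; _∷_; lookup)
open import Data.List using (List; []; _∷_; _++_; map; foldr)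
open import Data.Product using (∃; _×_)
open import Data.Sum using (_⊎_)
open import Data.Fin.Subset using (Subset; ⁅_⁆; _∪_; ⊥)
open import Algebra.Bundles using (CommutativeRing)
open import Relation.Nullary using (¬_)
open import Relation.Binary.Core using (Rel)
open import Relation.Binary.Structures using (IsStrictPartialOrder)
open import Relation.Binary.Definitions using (Trichotomous)

record OrderedField (c ℓ : Level) : Set (lsuc (c ⊔ ℓ)) where
  field
    commutativeRing : CommutativeRing c ℓ
  open CommutativeRing commutativeRing public
  field
    _<_                  : Rel Carrier ℓ
    isStrictPartialOrder : IsStrictPartialOrder _≈_ _<_
    trichotomous         : Trichotomous _≈_ _<_
    +-monoˡ-<            : ∀ {x y} z → x < y → (x + z) < (y + z)
    *-pos                : ∀ {x y} → 0# < x → 0# < y → 0# < (x * y)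
    0≉1                  : ¬ (0# ≈ 1#)
    inverse              : ∀ x → ¬ (x ≈ 0#) → ∃ λ y → (x * y) ≈ 1#

-- Finite combinatorics of the index set D = D(3,3)
-- Indices are 0-based: Fin 3 element zero is row/column 1,
-- suc zero is 2, suc (suc zero) is 3.

-- D is encoded as Fin 6:
--   0 ↦ ({},{}), 1 ↦ ({2},{2}), 2 ↦ ({2},{3}), 3 ↦ ({3},{2}),
--   4 ↦ ({3},{3}), 5 ↦ ({2,3},{2,3})
D : Set
D = Fin 6

e∅ e22 e23 e32 e33 eF : D
e∅  = zero
e22 = suc zero
e23 = suc (suc zero)
e32 = suc (suc (suc zero))
e33 = suc (suc (suc (suc zero)))
eF  = suc (suc (suc (suc (suc zero))))

i2 i3 : Fin 3
i2 = suc zero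
i3 = suc (suc zero)

size : D → ℕ
size zero = 0
size (suc zero) = 1
size (suc (suc zero)) = 1
size (suc (suc (suc zero))) = 1
size (suc (suc (suc (suc zero)))) = 1
size (suc (suc (suc (suc (suc zero))))) = 2

rowsOf : (d : D) → Vec (Fin 3) (size d)
rowsOf zero = []
rowsOf (suc zero) = i2 ∷ []
rowsOf (suc (suc zero)) = i2 ∷ []
rowsOf (suc (suc (suc zero))) = i3 ∷ []
rowsOf (suc (suc (suc (suc zero)))) = i3 ∷ []
rowsOf (suc (suc (suc (suc (suc zero))))) = i2 ∷ i3 ∷ []

colsOf : (d : D) → Vec (Fin 3) (size d)
colsOf zero = []
colsOf (suc zero) = i2 ∷ []
colsOf (suc (suc zero)) = i3 ∷ []
colsOf (suc (suc (suc zero))) = i2 ∷ []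
colsOf (suc (suc (suc (suc zero)))) = i3 ∷ []
colsOf (suc (suc (suc (suc (suc zero))))) = i2 ∷ i3 ∷ []

rowSwap : D → D
rowSwap zero = e∅
rowSwap (suc zero) = e32
rowSwap (suc (suc zero)) = e33
rowSwap (suc (suc (suc zero))) = e22
rowSwap (suc (suc (suc (suc zero)))) = e23
rowSwap (suc (suc (suc (suc (suc zero))))) = eF

colSwap : D → D
colSwap zero = e∅
colSwap (suc zero) = e23
colSwap (suc (suc zero)) = e22
colSwap (suc (suc (suc zero))) = e33
colSwap (suc (suc (suc (suc zero)))) = e32
colSwap (suc (suc (suc (suc (suc zero))))) = eF

transp : D → D
transp zero = e∅
transp (suc zero) = e22
transp (suc (suc zero)) = e32
transp (suc (suc (suc zero))) = e23
transp (suc (suc (suc (suc zero)))) = e33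
transp (suc (suc (suc (suc (suc zero))))) = eF

-- all 8 compositions rowSwap^a ∘ colSwap^b ∘ transp^t
-- (this is the whole group generated by the three generators)
pw : Bool → (D → D) → D → D
pw true  f = f
pw false f = λ d → d

symmetries : List (D → D)
symmetries = foldr (λ a acc → foldr (λ b acc₂ → foldr (λ t acc₃ →
               (λ d → pw a rowSwap (pw b colSwap (pw t transp d))) ∷ acc₃)
               acc₂ (true ∷ false ∷ [])) acc (true ∷ false ∷ []))
               [] (true ∷ false ∷ [])

allFinB : ∀ n → (Fin n → Bool) → Bool
allFinB zero    p = true
allFinB (suc n) p = p zero ∧ allFinB n (λ i → p (suc i))

anyB : ∀ {a} {A : Set a} → (A → Bool) → List A → Bool
anyB p = foldr (λ x b → p x ∨ b) false

_==B_ : Bool → Bool → Bool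
true  ==B b = b
false ==B true = false
false ==B false = true

-- g maps T onto S  iff  for all d : d ∈ T ⇔ g d ∈ S   (g is a bijection of D)
mapsOnto : (D → D) → Subset 6 → Subset 6 → Bool
mapsOnto g T S = allFinB 6 (λ d → lookup T d ==B lookup S (g d))

equivB : Subset 6 → Subset 6 → Bool
equivB T S = anyB (λ g → mapsOnto g T S) symmetries

allSubsets : ∀ n → List (Subset n)
allSubsets zero = [] ∷ []
allSubsets (suc n) = map (true ∷_) (allSubsets n) ++ map (false ∷_) (allSubsets n)

⟦_⟧ : List D → Subset 6
⟦ ds ⟧ = foldr (λ d s → ⁅ d ⁆ ∪ s) ⊥ ds

module Sinkhorn {c ℓ : Level} (F : OrderedField c ℓ) where
  open OrderedField F public using (Carrier; _≈_; _+_; _*_; -_; _-_; 0#; 1#; _<_)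

  Σ[_]_ : ∀ n → (Fin n → Carrier) → Carrier
  Σ[ zero ]  f = 0#
  Σ[ suc n ] f = f zero + Σ[ n ] (λ i → f (suc i))

  Π[_]_ : ∀ n → (Fin n → Carrier) → Carrier
  Π[ zero ]  f = 1#
  Π[ suc n ] f = f zero * Π[ n ] (λ i → f (suc i))

  sumL : List Carrier → Carrier
  sumL = foldr _+_ 0#

  _·_ : ℕ → Carrier → Carrier
  zero  · x = 0#
  suc n · x = x + n · x

  _^_ : Carrier → ℕ → Carrier
  x ^ zero  = 1#
  x ^ suc n = x * (x ^ n)

  sign : ℕ → Carrier
  sign zero = 1#
  sign (suc n) = - sign n

  det : ∀ n → (Fin n → Fin n → Carrier) → Carrier
  det zero    M = 1#
  det (suc n) M = Σ[ suc n ] (λ j →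
    sign (Data.Fin.toℕ j) * (M zero j * det n (λ i k → M (suc i) (punchIn j k))))

  Matrix3 : Set c
  Matrix3 = Fin 3 → Fin 3 → Carrier

  sub : ∀ {k} → Matrix3 → Vec (Fin 3) k → Vec (Fin 3) k → Fin k → Fin k → Carrier
  sub A I J i j = A (lookup I i) (lookup J j)

  Δ : Matrix3 → D → Carrier
  Δ A d = det (suc (size d)) (sub A (zero ∷ rowsOf d) (zero ∷ colsOf d))

  Γ : Matrix3 → D → Carrier
  Γ A d = A zero zero * det (size d) (sub A (rowsOf d) (colsOf d))

  M : Matrix3 → Subset 6 → Carrier
  M A S = Π[ 6 ] (λ d → if lookup S d then Δ A d else Γ A d)

  ΣC : Matrix3 → Subset 6 → Carrier
  ΣC A S = sumL (map (λ T → if equivB T S then M A T else 0#) (allSubsets 6))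

  coeffs : Matrix3 → Fin 7 → Carrier
  coeffs A zero = ΣC A ⟦ [] ⟧
  coeffs A (suc zero) =
    - (3 · ΣC A ⟦ e∅ ∷ [] ⟧) - ΣC A ⟦ e22 ∷ [] ⟧ + ΣC A ⟦ eF ∷ [] ⟧
  coeffs A (suc (suc zero)) =
    4 · ΣC A ⟦ e∅ ∷ e22 ∷ [] ⟧ - 3 · ΣC A ⟦ e∅ ∷ eF ∷ [] ⟧
    + ΣC A ⟦ e22 ∷ e33 ∷ [] ⟧
  coeffs A (suc (suc (suc zero))) =
    - (4 · ΣC A ⟦ e∅ ∷ e22 ∷ e23 ∷ [] ⟧) - 5 · ΣC A ⟦ e∅ ∷ e22 ∷ e33 ∷ [] ⟧
    + ΣC A ⟦ e∅ ∷ e22 ∷ eF ∷ [] ⟧ + ΣC A ⟦ e22 ∷ e23 ∷ e32 ∷ [] ⟧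
    - ΣC A ⟦ e22 ∷ e33 ∷ eF ∷ [] ⟧
  coeffs A (suc (suc (suc (suc zero)))) =
    4 · ΣC A ⟦ e∅ ∷ e22 ∷ e23 ∷ e32 ∷ [] ⟧ + ΣC A ⟦ e∅ ∷ e22 ∷ e33 ∷ eF ∷ [] ⟧
    - 3 · ΣC A ⟦ e22 ∷ e23 ∷ e32 ∷ e33 ∷ [] ⟧
  coeffs A (suc (suc (suc (suc (suc zero))))) =
    - (3 · ΣC A ⟦ e∅ ∷ e22 ∷ e23 ∷ e32 ∷ e33 ∷ [] ⟧)
    - ΣC A ⟦ e∅ ∷ e22 ∷ e23 ∷ e32 ∷ eF ∷ [] ⟧
    + ΣC A ⟦ e22 ∷ e23 ∷ e32 ∷ e33 ∷ eF ∷ [] ⟧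
  coeffs A (suc (suc (suc (suc (suc (suc zero)))))) =
    ΣC A ⟦ e∅ ∷ e22 ∷ e23 ∷ e32 ∷ e33 ∷ eF ∷ [] ⟧

  sinkPoly : Matrix3 → Carrier → Carrier
  sinkPoly A x = Σ[ 7 ] (λ k → coeffs A k * (x ^ Data.Fin.toℕ k))

  Positive : Matrix3 → Set ℓ
  Positive A = ∀ i j → 0# < A i j

  scaled : (Fin 3 → Carrier) → Matrix3 → (Fin 3 → Carrier) → Matrix3
  scaled r A c i j = (r i * A i j) * c j

  DoublyStochastic : Matrix3 → Set ℓ
  DoublyStochastic S =
    (∀ i → Σ[ 3 ] (λ j → S i j) ≈ 1#) × (∀ j → Σ[ 3 ] (λ i → S i j) ≈ 1#)
    × (∀ i j → 0# < S i j ⊎ S i j ≈ 0#)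

  IsSink : Matrix3 → Matrix3 → Set (c ⊔ ℓ)
  IsSink A S = DoublyStochastic S × ∃ λ r → ∃ λ c′ →
    (∀ i → 0# < r i) × (∀ j → 0# < c′ j) × (∀ i j → S i j ≈ scaled r A c′ i j)

module Submission where

-- If S = R A C with R, C positive diagonal, every minor Δ(R′,C′) and Γ(R′,C′) of S is the
-- corresponding minor of A times r₁c₁ ∏_{i∈R′} rᵢ ∏_{j∈C′} cⱼ.  Each M(T) is a product, over all
-- of D, of one such minor, so every M(T) of S is that of A times the same nonzero factor
-- K = ∏_{d∈D} r₁c₁ ∏ rᵢ ∏ cⱼ, and hence sinkPoly S = K · sinkPoly A.  A doubly stochastic S is
-- determined by its upper-left 2×2 block, and in terms of these four entries
-- sinkPoly S (S₁₁) vanishes identically: a polynomial identity with integer coefficients, checked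
-- by normalisation.

open import Level using (Level; 0ℓ)
open import Function using (_∘_)
open import Data.Nat as ℕ using (ℕ; zero; suc)
import Data.Nat.Properties as ℕ
open import Data.Integer as ℤ using (ℤ; +_; -[1+_]; _⊖_; _◃_)
import Data.Integer.Properties as ℤ
import Data.Sign as Sign
open import Data.Bool using (Bool; true; false; T; if_then_else_)
open import Data.Maybe using (nothing)
open import Data.Fin using (Fin; zero; suc; punchIn; toℕ; combine)
open import Data.Fin.Subset using (Subset)
open import Data.Vec using (Vec; []; _∷_; lookup; tabulate; concat)
open import Data.List using (List; []; _∷_; map; foldr)
open import Data.Product using (_,_)
open import Relation.Nullary using (¬_)
open import Relation.Binary.PropositionalEquality as ≡ using ()
open import Relation.Binary.Structures using (IsStrictPartialOrder)
import Relation.Binary.Reasoning.Setoid as ≈-Reasoning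
open import Algebra.Bundles using (CommutativeRing)
import Algebra.Solver.CommutativeMonoid
open import Tactic.RingSolver.Core.AlmostCommutativeRing using (fromCommutativeRing)
open import Tactic.RingSolver.Core.Polynomial.Parameters using (Homomorphism)
open import Tactic.RingSolver.Core.Expression using (Expr; Κ; Ι; _⊕_; _⊗_; ⊝_; _⊛_; module Eval)

-- Tactic.RingSolver draws its coefficients from the ring itself, so in an abstract ring it cannot
-- cancel them; with coefficients in ℤ the normal forms are computed outright.
module IntegerCoefficientSolver {c ℓ : Level} (R : CommutativeRing c ℓ) where
  open CommutativeRing R
  open import Algebra.Properties.Ring ring
    using (-0#≈0#; -‿involutive; -‿+-comm; -‿distribˡ-*; -‿distribʳ-*)
  open import Algebra.Properties.Semiring.Mult.TCOptimised semiring using (_×_; 1+×; ×-homo-+; ×1-homo-*)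
  open import Algebra.Properties.CommutativeSemigroup +-commutativeSemigroup using (interchange)
  open import Algebra.Properties.Semiring.Exp.TCOptimised semiring using (^-congˡ)
  open ≈-Reasoning setoid

  ι : ℕ → Carrier
  ι n = n × 1#

  ⟦_⟧ℤ : ℤ → Carrier
  ⟦ + n ⟧ℤ      = ι n
  ⟦ -[1+ n ] ⟧ℤ = - ι (suc n)

  ⟦⊖⟧ : ∀ m n → ⟦ m ⊖ n ⟧ℤ ≈ ι m - ι n
  ⟦⊖⟧ m       zero    rewrite ℤ.⊖-≥ (ℕ.z≤n {m}) = sym (trans (+-congˡ -0#≈0#) (+-identityʳ _))
  ⟦⊖⟧ zero    (suc n) rewrite ℤ.⊖-< (ℕ.z<s {n}) = sym (+-identityˡ _)
  ⟦⊖⟧ (suc m) (suc n) rewrite ℤ.[1+m]⊖[1+n]≡m⊖n m n = begin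
    ⟦ m ⊖ n ⟧ℤ                    ≈⟨ ⟦⊖⟧ m n ⟩
    ι m - ι n                     ≈⟨ +-identityˡ _ ⟨
    0# + (ι m - ι n)              ≈⟨ +-congʳ (-‿inverseʳ 1#) ⟨
    (1# - 1#) + (ι m - ι n)       ≈⟨ interchange _ _ _ _ ⟩
    (1# + ι m) + (- 1# + - ι n)   ≈⟨ +-cong (sym (1+× m 1#)) (-‿+-comm _ _) ⟩
    ι (suc m) + - (1# + ι n)      ≈⟨ +-congˡ (-‿cong (1+× n 1#)) ⟨
    ι (suc m) - ι (suc n)         ∎

  ⟦-⟧ : ∀ i → ⟦ ℤ.- i ⟧ℤ ≈ - ⟦ i ⟧ℤ
  ⟦-⟧ (+ zero)  = sym -0#≈0#
  ⟦-⟧ (+ suc n) = refl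
  ⟦-⟧ -[1+ n ]  = sym (-‿involutive _)

  ⟦+⟧ : ∀ i j → ⟦ i ℤ.+ j ⟧ℤ ≈ ⟦ i ⟧ℤ + ⟦ j ⟧ℤ
  ⟦+⟧ (+ m)    (+ n)    = ×-homo-+ 1# m n
  ⟦+⟧ (+ m)    -[1+ n ] = ⟦⊖⟧ m (suc n)
  ⟦+⟧ -[1+ m ] (+ n)    = trans (⟦⊖⟧ n (suc m)) (+-comm _ _)
  ⟦+⟧ -[1+ m ] -[1+ n ] = begin
    - ι (suc (suc m ℕ.+ n))       ≡⟨ ≡.cong (-_ ∘ ι) (ℕ.+-suc (suc m) n) ⟨
    - ι (suc m ℕ.+ suc n)         ≈⟨ -‿cong (×-homo-+ 1# (suc m) (suc n)) ⟩
    - (ι (suc m) + ι (suc n))     ≈⟨ -‿+-comm _ _ ⟨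
    - ι (suc m) + - ι (suc n)     ∎

  ⟦+◃⟧ : ∀ n → ⟦ Sign.+ ◃ n ⟧ℤ ≈ ι n
  ⟦+◃⟧ zero    = refl
  ⟦+◃⟧ (suc n) = refl

  ⟦-◃⟧ : ∀ n → ⟦ Sign.- ◃ n ⟧ℤ ≈ - ι n
  ⟦-◃⟧ zero    = sym -0#≈0#
  ⟦-◃⟧ (suc n) = refl

  ⟦*⟧ : ∀ i j → ⟦ i ℤ.* j ⟧ℤ ≈ ⟦ i ⟧ℤ * ⟦ j ⟧ℤ
  ⟦*⟧ (+ m)    (+ n)    = trans (⟦+◃⟧ (m ℕ.* n)) (×1-homo-* m n)
  ⟦*⟧ (+ m)    -[1+ n ] =
    trans (⟦-◃⟧ (m ℕ.* suc n)) (trans (-‿cong (×1-homo-* m (suc n))) (-‿distribʳ-* _ _))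
  ⟦*⟧ -[1+ m ] (+ n)    =
    trans (⟦-◃⟧ (suc m ℕ.* n)) (trans (-‿cong (×1-homo-* (suc m) n)) (-‿distribˡ-* _ _))
  ⟦*⟧ -[1+ m ] -[1+ n ] = begin
    ⟦ Sign.+ ◃ (suc m ℕ.* suc n) ⟧ℤ  ≈⟨ ⟦+◃⟧ (suc m ℕ.* suc n) ⟩
    ι (suc m ℕ.* suc n)              ≈⟨ ×1-homo-* (suc m) (suc n) ⟩
    ι (suc m) * ι (suc n)            ≈⟨ -‿involutive _ ⟨
    - - (ι (suc m) * ι (suc n))      ≈⟨ -‿cong (-‿distribʳ-* _ _) ⟩
    - (ι (suc m) * - ι (suc n))      ≈⟨ -‿distribˡ-* _ _ ⟩
    - ι (suc m) * - ι (suc n)        ∎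

  isZero : ℤ → Bool
  isZero (+ zero) = true
  isZero _        = false

  isZero-sound : ∀ i → T (isZero i) → 0# ≈ ⟦ i ⟧ℤ
  isZero-sound (+ zero) _ = refl

  homomorphism : Homomorphism 0ℓ 0ℓ c ℓ
  homomorphism = record
    { from          = record { rawRing = CommutativeRing.rawRing ℤ.+-*-commutativeRing ; isZero = isZero }
    ; to            = fromCommutativeRing R (λ _ → nothing)
    ; morphism      = record
      { ⟦_⟧    = ⟦_⟧ℤ
      ; +-homo = ⟦+⟧
      ; *-homo = ⟦*⟧
      ; -‿homo = ⟦-⟧
      ; 0-homo = refl
      ; 1-homo = refl
      }
    ; Zero-C⟶Zero-R = isZero-sound
    }

  open Eval rawRing ⟦_⟧ℤ public using (⟦_⟧)
  open import Tactic.RingSolver.Core.Polynomial.Base (Homomorphism.from homomorphism)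
    using (Poly; κ; _⊞_; _⊠_; ⊟_; _⊡_) renaming (ι to ιₚ)
  open import Tactic.RingSolver.Core.Polynomial.Semantics homomorphism renaming (⟦_⟧ to ⟦_⟧ₚ)
  open import Tactic.RingSolver.Core.Polynomial.Homomorphism homomorphism

  norm : ∀ {n} → Expr ℤ n → Poly n
  norm (Κ x)   = κ x
  norm (Ι x)   = ιₚ x
  norm (x ⊕ y) = norm x ⊞ norm y
  norm (x ⊗ y) = norm x ⊠ norm y
  norm (⊝ x)   = ⊟ norm x
  norm (x ⊛ i) = norm x ⊡ i

  norm-correct : ∀ {n} (e : Expr ℤ n) ρ → ⟦ norm e ⟧ₚ ρ ≈ ⟦ e ⟧ ρ
  norm-correct (Κ x)   ρ = κ-hom x ρ
  norm-correct (Ι x)   ρ = ι-hom x ρ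
  norm-correct (x ⊕ y) ρ = trans (⊞-hom (norm x) (norm y) ρ) (+-cong (norm-correct x ρ) (norm-correct y ρ))
  norm-correct (x ⊗ y) ρ = trans (⊠-hom (norm x) (norm y) ρ) (*-cong (norm-correct x ρ) (norm-correct y ρ))
  norm-correct (⊝ x)   ρ = trans (⊟-hom (norm x) ρ) (-‿cong (norm-correct x ρ))
  norm-correct (x ⊛ i) ρ = trans (⊡-hom (norm x) i ρ) (^-congˡ i (norm-correct x ρ))

  open import Relation.Binary.Reflection setoid Ι ⟦_⟧ (λ e → ⟦ norm e ⟧ₚ) norm-correct public
    using (prove; solve; _⊜_)

open import Defs

-- Verbatim copies of the definitions of Defs.Sinkhorn (and of `completion` below) over solver
-- expressions: ⟦_⟧ sends each of them definitionally to its namesake, so an identity between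
-- them is decided by `prove` with `refl`.

module Symbolic (n : ℕ) where
  infixl 6 _+_ _-_
  infixl 7 _*_
  infix  8 -_

  Term : Set
  Term = Expr ℤ n

  0# 1# : Term
  0# = Κ (+ 0)
  1# = Κ (+ 1)

  -_ : Term → Term
  -_ = ⊝_

  _+_ _*_ _-_ : Term → Term → Term
  _+_ = _⊕_
  _*_ = _⊗_
  x - y = x + - y

  Σ[_]_ : ∀ m → (Fin m → Term) → Term
  Σ[ zero ]  f = 0#
  Σ[ suc m ] f = f zero + Σ[ m ] (λ i → f (suc i))

  Π[_]_ : ∀ m → (Fin m → Term) → Term
  Π[ zero ]  f = 1#
  Π[ suc m ] f = f zero * Π[ m ] (λ i → f (suc i))

  sumL : List Term → Term
  sumL = foldr _+_ 0#

  _·_ : ℕ → Term → Term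
  zero  · x = 0#
  suc m · x = x + m · x

  _^_ : Term → ℕ → Term
  x ^ zero  = 1#
  x ^ suc m = x * (x ^ m)

  sign : ℕ → Term
  sign zero    = 1#
  sign (suc m) = - sign m

  det : ∀ m → (Fin m → Fin m → Term) → Term
  det zero    M = 1#
  det (suc m) M = Σ[ suc m ] (λ j →
    sign (toℕ j) * (M zero j * det m (λ i k → M (suc i) (punchIn j k))))

  Matrix3 : Set
  Matrix3 = Fin 3 → Fin 3 → Term

  sub : ∀ {k} → Matrix3 → Vec (Fin 3) k → Vec (Fin 3) k → Fin k → Fin k → Term
  sub A I J i j = A (lookup I i) (lookup J j)

  Δ : Matrix3 → D → Term
  Δ A d = det (suc (size d)) (sub A (zero ∷ rowsOf d) (zero ∷ colsOf d))

  Γ : Matrix3 → D → Term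
  Γ A d = A zero zero * det (size d) (sub A (rowsOf d) (colsOf d))

  M : Matrix3 → Subset 6 → Term
  M A S = Π[ 6 ] (λ d → if lookup S d then Δ A d else Γ A d)

  ΣC : Matrix3 → Subset 6 → Term
  ΣC A S = sumL (map (λ T → if equivB T S then M A T else 0#) (allSubsets 6))

  coeffs : Matrix3 → Fin 7 → Term
  coeffs A zero = ΣC A ⟦ [] ⟧
  coeffs A (suc zero) =
    - (3 · ΣC A ⟦ e∅ ∷ [] ⟧) - ΣC A ⟦ e22 ∷ [] ⟧ + ΣC A ⟦ eF ∷ [] ⟧
  coeffs A (suc (suc zero)) =
    4 · ΣC A ⟦ e∅ ∷ e22 ∷ [] ⟧ - 3 · ΣC A ⟦ e∅ ∷ eF ∷ [] ⟧
    + ΣC A ⟦ e22 ∷ e33 ∷ [] ⟧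
  coeffs A (suc (suc (suc zero))) =
    - (4 · ΣC A ⟦ e∅ ∷ e22 ∷ e23 ∷ [] ⟧) - 5 · ΣC A ⟦ e∅ ∷ e22 ∷ e33 ∷ [] ⟧
    + ΣC A ⟦ e∅ ∷ e22 ∷ eF ∷ [] ⟧ + ΣC A ⟦ e22 ∷ e23 ∷ e32 ∷ [] ⟧
    - ΣC A ⟦ e22 ∷ e33 ∷ eF ∷ [] ⟧
  coeffs A (suc (suc (suc (suc zero)))) =
    4 · ΣC A ⟦ e∅ ∷ e22 ∷ e23 ∷ e32 ∷ [] ⟧ + ΣC A ⟦ e∅ ∷ e22 ∷ e33 ∷ eF ∷ [] ⟧
    - 3 · ΣC A ⟦ e22 ∷ e23 ∷ e32 ∷ e33 ∷ [] ⟧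
  coeffs A (suc (suc (suc (suc (suc zero))))) =
    - (3 · ΣC A ⟦ e∅ ∷ e22 ∷ e23 ∷ e32 ∷ e33 ∷ [] ⟧)
    - ΣC A ⟦ e∅ ∷ e22 ∷ e23 ∷ e32 ∷ eF ∷ [] ⟧
    + ΣC A ⟦ e22 ∷ e23 ∷ e32 ∷ e33 ∷ eF ∷ [] ⟧
  coeffs A (suc (suc (suc (suc (suc (suc zero)))))) =
    ΣC A ⟦ e∅ ∷ e22 ∷ e23 ∷ e32 ∷ e33 ∷ eF ∷ [] ⟧

  sinkPoly : Matrix3 → Term → Term
  sinkPoly A x = Σ[ 7 ] (λ k → coeffs A k * (x ^ toℕ k))

  completion : Matrix3 → Matrix3
  completion A (suc (suc zero)) (suc (suc zero)) = A zero zero + A zero i2 + A i2 zero + A i2 i2 - 1#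
  completion A i                (suc (suc zero)) = 1# - A i zero - A i i2
  completion A (suc (suc zero)) j                = 1# - A zero j - A i2 j
  completion A i                j                = A i j

module SinkhornProperties {c ℓ : Level} (F : OrderedField c ℓ) where
  open Sinkhorn F
  open OrderedField F using (commutativeRing; ring; setoid; *-commutativeMonoid; *-commutativeSemigroup;
    isStrictPartialOrder; *-pos; inverse; refl; sym; trans; +-cong; +-congˡ; +-congʳ; -‿cong;
    *-cong; *-congˡ; *-congʳ; *-assoc; *-comm; *-identityˡ; *-identityʳ; zeroʳ; distribˡ)
  open IsStrictPartialOrder isStrictPartialOrder using (irrefl; <-respʳ-≈)
  open import Algebra.Properties.Ring ring using (-‿distribʳ-*)
  open import Algebra.Properties.CommutativeSemigroup *-commutativeSemigroup using (interchange; x∙yz≈y∙xz)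
  module ⋆ = Algebra.Solver.CommutativeMonoid *-commutativeMonoid
  open IntegerCoefficientSolver commutativeRing using (prove; solve; _⊜_)
  open ≈-Reasoning setoid

  Σ-cong : ∀ n {f g : Fin n → Carrier} → (∀ i → f i ≈ g i) → Σ[ n ] f ≈ Σ[ n ] g
  Σ-cong zero    f≈g = refl
  Σ-cong (suc n) f≈g = +-cong (f≈g zero) (Σ-cong n (f≈g ∘ suc))

  Σ-scale : ∀ n K {f g : Fin n → Carrier} → (∀ i → f i ≈ K * g i) → Σ[ n ] f ≈ K * Σ[ n ] g
  Σ-scale zero    K f≈Kg = sym (zeroʳ K)
  Σ-scale (suc n) K f≈Kg = trans (+-cong (f≈Kg zero) (Σ-scale n K (f≈Kg ∘ suc))) (sym (distribˡ K _ _))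

  sumL-scale : ∀ K {A : Set} (f g : A → Carrier) → (∀ a → f a ≈ K * g a) →
               ∀ as → sumL (map f as) ≈ K * sumL (map g as)
  sumL-scale K f g f≈Kg []       = sym (zeroʳ K)
  sumL-scale K f g f≈Kg (a ∷ as) =
    trans (+-cong (f≈Kg a) (sumL-scale K f g f≈Kg as)) (sym (distribˡ K _ _))

  Π-one : ∀ n → Π[ n ] (λ _ → 1#) ≈ 1#
  Π-one zero    = refl
  Π-one (suc n) = trans (*-identityˡ _) (Π-one n)

  Π-scale : ∀ n {f g k : Fin n → Carrier} → (∀ i → f i ≈ k i * g i) →
            Π[ n ] f ≈ Π[ n ] k * Π[ n ] g
  Π-scale zero    f≈kg = sym (*-identityˡ 1#)
  Π-scale (suc n) f≈kg = trans (*-cong (f≈kg zero) (Π-scale n (f≈kg ∘ suc))) (interchange _ _ _ _)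

  Π-punchIn : ∀ n (f : Fin (suc n) → Carrier) j → Π[ suc n ] f ≈ f j * Π[ n ] (f ∘ punchIn j)
  Π-punchIn n       f zero    = refl
  Π-punchIn (suc n) f (suc j) = trans (*-congˡ (Π-punchIn n (f ∘ suc) j)) (x∙yz≈y∙xz _ _ _)

  Π-pos : ∀ n {f : Fin (suc n) → Carrier} → (∀ i → 0# < f i) → 0# < (Π[ suc n ] f)
  Π-pos zero    f>0 = <-respʳ-≈ (sym (*-identityʳ _)) (f>0 zero)
  Π-pos (suc n) f>0 = *-pos (f>0 zero) (Π-pos n (f>0 ∘ suc))

  det-cong : ∀ n {M N : Fin n → Fin n → Carrier} → (∀ i j → M i j ≈ N i j) → det n M ≈ det n N
  det-cong zero    M≈N = refl
  det-cong (suc n) M≈N = Σ-cong (suc n) λ j →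
    *-congˡ {sign (toℕ j)} (*-cong (M≈N zero j) (det-cong n (λ i k → M≈N (suc i) (punchIn j k))))

  det-scaled : ∀ n (r c : Fin n → Carrier) {M N : Fin n → Fin n → Carrier} →
               (∀ i j → N i j ≈ (r i * M i j) * c j) → det n N ≈ (Π[ n ] r * Π[ n ] c) * det n M
  det-scaled zero    r c N≈rMc = sym (trans (*-identityʳ _) (*-identityʳ 1#))
  det-scaled (suc n) r c {M} {N} N≈rMc = Σ-scale (suc n) _ expansionTerm
    where
    minor : (Fin (suc n) → Fin (suc n) → Carrier) → Fin (suc n) → Fin n → Fin n → Carrier
    minor P j i k = P (suc i) (punchIn j k)

    expansionTerm : ∀ j → sign (toℕ j) * (N zero j * det n (minor N j))
                        ≈ (Π[ suc n ] r * Π[ suc n ] c) * (sign (toℕ j) * (M zero j * det n (minor M j)))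
    expansionTerm j = begin
      sign (toℕ j) * (N zero j * det n (minor N j))
        ≈⟨ *-congˡ (*-cong (N≈rMc zero j)
             (det-scaled n (r ∘ suc) (c ∘ punchIn j) (λ i k → N≈rMc (suc i) (punchIn j k)))) ⟩
      sign (toℕ j) * ((r zero * M zero j * c j)
                      * (Π[ n ] (r ∘ suc) * Π[ n ] (c ∘ punchIn j) * det n (minor M j)))
        ≈⟨ ⋆.solve 7 (λ s a m b R C d → s ⋆.⊕ (((a ⋆.⊕ m) ⋆.⊕ b) ⋆.⊕ ((R ⋆.⊕ C) ⋆.⊕ d))
                                      ⋆.⊜ ((a ⋆.⊕ R) ⋆.⊕ (b ⋆.⊕ C)) ⋆.⊕ (s ⋆.⊕ (m ⋆.⊕ d)))
                     refl _ _ _ _ _ _ _ ⟩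
      (Π[ suc n ] r * (c j * Π[ n ] (c ∘ punchIn j))) * (sign (toℕ j) * (M zero j * det n (minor M j)))
        ≈⟨ *-congʳ (*-congˡ (Π-punchIn n c j)) ⟨
      (Π[ suc n ] r * Π[ suc n ] c) * (sign (toℕ j) * (M zero j * det n (minor M j)))
        ∎

  module _ (K : Carrier) where
    +-scale : ∀ {x y x′ y′} → x′ ≈ K * x → y′ ≈ K * y → x′ + y′ ≈ K * (x + y)
    +-scale x′≈Kx y′≈Ky = trans (+-cong x′≈Kx y′≈Ky) (sym (distribˡ K _ _))

    -‿scale : ∀ {x x′} → x′ ≈ K * x → - x′ ≈ K * (- x)
    -‿scale x′≈Kx = trans (-‿cong x′≈Kx) (-‿distribʳ-* K _)

    ·-scale : ∀ n {x x′} → x′ ≈ K * x → n · x′ ≈ K * (n · x)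
    ·-scale zero    x′≈Kx = sym (zeroʳ K)
    ·-scale (suc n) x′≈Kx = +-scale x′≈Kx (·-scale n x′≈Kx)

    if-scale : ∀ b {x y x′ y′} → x′ ≈ K * x → y′ ≈ K * y →
               (if b then x′ else y′) ≈ K * (if b then x else y)
    if-scale true  x′≈Kx y′≈Ky = x′≈Kx
    if-scale false x′≈Kx y′≈Ky = y′≈Ky

  module _ {A B : Matrix3} (k : D → Carrier)
           (Δ-hom : ∀ d → Δ B d ≈ k d * Δ A d) (Γ-hom : ∀ d → Γ B d ≈ k d * Γ A d) where

    M-homogeneous : ∀ T → M B T ≈ Π[ 6 ] k * M A T
    M-homogeneous T = Π-scale 6 (λ d → if-scale (k d) (lookup T d) (Δ-hom d) (Γ-hom d))

    ΣC-homogeneous : ∀ S → ΣC B S ≈ Π[ 6 ] k * ΣC A S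
    ΣC-homogeneous S = sumL-scale (Π[ 6 ] k) _ _
      (λ T → if-scale (Π[ 6 ] k) (equivB T S) (M-homogeneous T) (sym (zeroʳ _)))
      (allSubsets 6)

    private
      infixl 6 _⊞_
      infixr 7 _⊠_
      infix  8 ⊟_

      _⊞_ = +-scale (Π[ 6 ] k)
      ⊟_  = -‿scale (Π[ 6 ] k)
      _⊠_ = ·-scale (Π[ 6 ] k)

      σ : ∀ S → ΣC B S ≈ Π[ 6 ] k * ΣC A S
      σ = ΣC-homogeneous

    -- The subsets are spelled out (rather than left to unification) because solving
    -- ΣC B ?S against ΣC B ⟦ … ⟧ would unfold ΣC completely.
    coeffs-homogeneous : ∀ i → coeffs B i ≈ Π[ 6 ] k * coeffs A i
    coeffs-homogeneous zero = σ ⟦ [] ⟧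
    coeffs-homogeneous (suc zero) =
      ⊟ (3 ⊠ σ ⟦ e∅ ∷ [] ⟧) ⊞ ⊟ σ ⟦ e22 ∷ [] ⟧ ⊞ σ ⟦ eF ∷ [] ⟧
    coeffs-homogeneous (suc (suc zero)) =
      4 ⊠ σ ⟦ e∅ ∷ e22 ∷ [] ⟧ ⊞ ⊟ (3 ⊠ σ ⟦ e∅ ∷ eF ∷ [] ⟧)
      ⊞ σ ⟦ e22 ∷ e33 ∷ [] ⟧
    coeffs-homogeneous (suc (suc (suc zero))) =
      ⊟ (4 ⊠ σ ⟦ e∅ ∷ e22 ∷ e23 ∷ [] ⟧) ⊞ ⊟ (5 ⊠ σ ⟦ e∅ ∷ e22 ∷ e33 ∷ [] ⟧)
      ⊞ σ ⟦ e∅ ∷ e22 ∷ eF ∷ [] ⟧ ⊞ σ ⟦ e22 ∷ e23 ∷ e32 ∷ [] ⟧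
      ⊞ ⊟ σ ⟦ e22 ∷ e33 ∷ eF ∷ [] ⟧
    coeffs-homogeneous (suc (suc (suc (suc zero)))) =
      4 ⊠ σ ⟦ e∅ ∷ e22 ∷ e23 ∷ e32 ∷ [] ⟧ ⊞ σ ⟦ e∅ ∷ e22 ∷ e33 ∷ eF ∷ [] ⟧
      ⊞ ⊟ (3 ⊠ σ ⟦ e22 ∷ e23 ∷ e32 ∷ e33 ∷ [] ⟧)
    coeffs-homogeneous (suc (suc (suc (suc (suc zero))))) =
      ⊟ (3 ⊠ σ ⟦ e∅ ∷ e22 ∷ e23 ∷ e32 ∷ e33 ∷ [] ⟧)
      ⊞ ⊟ σ ⟦ e∅ ∷ e22 ∷ e23 ∷ e32 ∷ eF ∷ [] ⟧
      ⊞ σ ⟦ e22 ∷ e23 ∷ e32 ∷ e33 ∷ eF ∷ [] ⟧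
    coeffs-homogeneous (suc (suc (suc (suc (suc (suc zero)))))) =
      σ ⟦ e∅ ∷ e22 ∷ e23 ∷ e32 ∷ e33 ∷ eF ∷ [] ⟧

    sinkPoly-homogeneous : ∀ x → sinkPoly B x ≈ Π[ 6 ] k * sinkPoly A x
    sinkPoly-homogeneous x =
      Σ-scale 7 (Π[ 6 ] k) {λ i → coeffs B i * (x ^ toℕ i)} {λ i → coeffs A i * (x ^ toℕ i)}
        (λ i → trans (*-congʳ (coeffs-homogeneous i)) (*-assoc _ _ _))

  sinkPoly-cong : ∀ {A B} → (∀ i j → A i j ≈ B i j) → ∀ x → sinkPoly A x ≈ sinkPoly B x
  sinkPoly-cong {A} {B} A≈B x = begin
    sinkPoly A x                      ≈⟨ sinkPoly-homogeneous {B} {A} (λ _ → 1#) Δ≈ Γ≈ x ⟩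
    Π[ 6 ] (λ _ → 1#) * sinkPoly B x  ≈⟨ trans (*-congʳ (Π-one 6)) (*-identityˡ _) ⟩
    sinkPoly B x                      ∎
    where
    Δ≈ : ∀ d → Δ A d ≈ 1# * Δ B d
    Δ≈ d = trans (det-cong (suc (size d)) λ i j → A≈B (lookup (zero ∷ rowsOf d) i) (lookup (zero ∷ colsOf d) j))
                 (sym (*-identityˡ _))

    Γ≈ : ∀ d → Γ A d ≈ 1# * Γ B d
    Γ≈ d = trans (*-cong (A≈B zero zero) (det-cong (size d) λ i j → A≈B (lookup (rowsOf d) i) (lookup (colsOf d) j)))
                 (sym (*-identityˡ _))

  scalingFactor : (r c : Fin 3 → Carrier) → D → Carrier
  scalingFactor r c d = Π[ suc (size d) ] (r ∘ lookup (zero ∷ rowsOf d))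
                      * Π[ suc (size d) ] (c ∘ lookup (zero ∷ colsOf d))

  scalingFactor-pos : ∀ {r c} → (∀ i → 0# < r i) → (∀ j → 0# < c j) →
                      ∀ d → 0# < scalingFactor r c d
  scalingFactor-pos r>0 c>0 d =
    *-pos (Π-pos (size d) (r>0 ∘ lookup (zero ∷ rowsOf d))) (Π-pos (size d) (c>0 ∘ lookup (zero ∷ colsOf d)))

  module _ {A B : Matrix3} (r c : Fin 3 → Carrier) (B≈rAc : ∀ i j → B i j ≈ (r i * A i j) * c j) where

    Δ-scaled : ∀ d → Δ B d ≈ scalingFactor r c d * Δ A d
    Δ-scaled d = det-scaled (suc (size d)) (r ∘ lookup (zero ∷ rowsOf d)) (c ∘ lookup (zero ∷ colsOf d))
                            (λ i j → B≈rAc _ _)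

    Γ-scaled : ∀ d → Γ B d ≈ scalingFactor r c d * Γ A d
    Γ-scaled d = trans
      (*-cong (B≈rAc zero zero)
              (det-scaled (size d) (r ∘ lookup (rowsOf d)) (c ∘ lookup (colsOf d)) (λ i j → B≈rAc _ _)))
      (⋆.solve 6 (λ a x b R C y → ((a ⋆.⊕ x) ⋆.⊕ b) ⋆.⊕ ((R ⋆.⊕ C) ⋆.⊕ y)
                              ⋆.⊜ ((a ⋆.⊕ R) ⋆.⊕ (b ⋆.⊕ C)) ⋆.⊕ (x ⋆.⊕ y)) refl _ _ _ _ _ _)

  0<x⇒x≉0 : ∀ {x} → 0# < x → ¬ (x ≈ 0#)
  0<x⇒x≉0 0<x x≈0 = irrefl (sym x≈0) 0<x

  x≉0∧x*y≈0⇒y≈0 : ∀ {x y} → ¬ (x ≈ 0#) → x * y ≈ 0# → y ≈ 0#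
  x≉0∧x*y≈0⇒y≈0 {x} {y} x≉0 xy≈0 with inverse x x≉0
  ... | x⁻¹ , xx⁻¹≈1 = begin
    y                ≈⟨ *-identityˡ y ⟨
    1# * y           ≈⟨ *-congʳ (trans (sym xx⁻¹≈1) (*-comm x x⁻¹)) ⟩
    (x⁻¹ * x) * y    ≈⟨ *-assoc x⁻¹ x y ⟩
    x⁻¹ * (x * y)    ≈⟨ *-congˡ xy≈0 ⟩
    x⁻¹ * 0#         ≈⟨ zeroʳ x⁻¹ ⟩
    0#               ∎

  completion : Matrix3 → Matrix3
  completion A (suc (suc zero)) (suc (suc zero)) = A zero zero + A zero i2 + A i2 zero + A i2 i2 - 1#
  completion A i                (suc (suc zero)) = 1# - A i zero - A i i2
  completion A (suc (suc zero)) j                = 1# - A zero j - A i2 j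
  completion A i                j                = A i j

  Σ₃≈1⇒last : ∀ (f : Fin 3 → Carrier) → Σ[ 3 ] f ≈ 1# → f i3 ≈ 1# - f zero - f i2
  Σ₃≈1⇒last f Σf≈1 = begin
    f i3
      ≈⟨ solve 3 (λ x y z → z ⊜ x ⊕ (y ⊕ (z ⊕ Κ (+ 0))) ⊕ ⊝ x ⊕ ⊝ y) refl _ _ _ ⟩
    Σ[ 3 ] f - f zero - f i2
      ≈⟨ +-congʳ (+-congʳ Σf≈1) ⟩
    1# - f zero - f i2
      ∎

  module _ {S : Matrix3} (rows : ∀ i → Σ[ 3 ] (λ j → S i j) ≈ 1#)
                         (cols : ∀ j → Σ[ 3 ] (λ i → S i j) ≈ 1#) where

    stochastic≈completion : ∀ i j → S i j ≈ completion S i j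
    stochastic≈completion zero             zero             = refl
    stochastic≈completion zero             (suc zero)       = refl
    stochastic≈completion (suc zero)       zero             = refl
    stochastic≈completion (suc zero)       (suc zero)       = refl
    stochastic≈completion zero             (suc (suc zero)) = Σ₃≈1⇒last (S zero) (rows zero)
    stochastic≈completion (suc zero)       (suc (suc zero)) = Σ₃≈1⇒last (S i2) (rows i2)
    stochastic≈completion (suc (suc zero)) zero             = Σ₃≈1⇒last (λ i → S i zero) (cols zero)
    stochastic≈completion (suc (suc zero)) (suc zero)       = Σ₃≈1⇒last (λ i → S i i2) (cols i2)
    stochastic≈completion (suc (suc zero)) (suc (suc zero)) = begin
      S i3 i3
        ≈⟨ Σ₃≈1⇒last (S i3) (rows i3) ⟩
      1# - S i3 zero - S i3 i2
        ≈⟨ +-cong (+-congˡ (-‿cong (Σ₃≈1⇒last (λ i → S i zero) (cols zero))))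
                  (-‿cong (Σ₃≈1⇒last (λ i → S i i2) (cols i2))) ⟩
      1# - (1# - S zero zero - S i2 zero) - (1# - S zero i2 - S i2 i2)
        ≈⟨ solve 4 (λ a b c d → Κ (+ 1) ⊕ ⊝ (Κ (+ 1) ⊕ ⊝ a ⊕ ⊝ c) ⊕ ⊝ (Κ (+ 1) ⊕ ⊝ b ⊕ ⊝ d)
                            ⊜ a ⊕ b ⊕ c ⊕ d ⊕ ⊝ Κ (+ 1)) refl _ _ _ _ ⟩
      S zero zero + S zero i2 + S i2 zero + S i2 i2 - 1#
        ∎

  sinkPoly-completion : ∀ A → sinkPoly (completion A) (A zero zero) ≈ 0#
  sinkPoly-completion A =
    prove (entries A) (Sym.sinkPoly (Sym.completion entry) (entry zero zero)) Sym.0# refl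
    where
    module Sym = Symbolic 9

    entries : Matrix3 → Vec Carrier 9
    entries A = concat (tabulate (tabulate ∘ A))

    entry : Fin 3 → Fin 3 → Sym.Term
    entry i j = Ι (combine i j)

theorem2p4 : ∀ {c ℓ : Level} (F : OrderedField c ℓ) →
    let open Sinkhorn F in
    (A S : Matrix3) → Positive A → IsSink A S →
    sinkPoly A (S zero zero) ≈ 0#
theorem2p4 F A S _ ((rows , cols , _) , r , c , r>0 , c>0 , S≈rAc) =
  x≉0∧x*y≈0⇒y≈0 (0<x⇒x≉0 (Π-pos 5 {scalingFactor r c} (scalingFactor-pos r>0 c>0))) (begin
    Π[ 6 ] (scalingFactor r c) * sinkPoly A (S zero zero)
      ≈⟨ sinkPoly-homogeneous {A} {S} (scalingFactor r c) (Δ-scaled r c S≈rAc) (Γ-scaled r c S≈rAc) (S zero zero) ⟨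
    sinkPoly S (S zero zero)
      ≈⟨ sinkPoly-cong {S} {completion S} (stochastic≈completion {S} rows cols) (S zero zero) ⟩
    sinkPoly (completion S) (S zero zero)
      ≈⟨ sinkPoly-completion S ⟩
    0# ∎)
  where
  open Sinkhorn F
  open SinkhornProperties F
  open ≈-Reasoning (OrderedField.setoid F)
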